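{- For any integer $j$, $$ s_{2j}(n)-1=(n+2)\, r_j(n)\,\mathcal{U}_{j-1}(n), \qquad s_{2j+1}(n)+1=(n+2)\, r_j(n)\,\mathcal{U}_j(n). $$
   Context: The sequence $(s_k(n))_{k\in\mathbb{Z}}$ is defined by $s_0(n)=1$, $s_1(n)=n+1$, $s_{k+2}(n)=n\,s_{k+1}(n)-s_k(n)$, and $(r_k(n))_{k\in\mathbb{Z}}$ by the same recurrence with $r_0(n)=1$, $r_1(n)=n-1$. The dilated Chebyshev polynomials of the second kind satisfy $\mathcal{U}_0=1$, $\mathcal{U}_1(x)=x$, $\mathcal{U}_{k+2}(x)=x\,\mathcal{U}_{k+1}(x)-\mathcal{U}_k(x)$ for all $k\in\mathbb{Z}$ (so $\mathcal{U}_{ -1}=0$); equivalently $\mathcal{U}_k(2\cos\theta)=\sin((k+1)\theta)/\sin\theta$. -}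

module Defs where

open import Data.Nat using (ℕ; zero; suc)
open import Data.Integer using (ℤ; +_; -[1+_]; _+_; _-_; _*_; -_)
open import Data.Product using (_×_; _,_; proj₁)

-- Two-sided linear recurrence a_{k+2} = n a_{k+1} - a_k on ℤ-indices,
-- determined by a_0 = a0 and a_1 = a1.

fwd : ℤ → ℤ → ℤ → ℕ → ℤ × ℤ
fwd n a0 a1 zero = a0 , a1
fwd n a0 a1 (suc k) with fwd n a0 a1 k
... | x , y = y , n * y - x

-- backward pairs: bwd k = (a_{-k} , a_{-k+1}),  using a_k = n a_{k+1} - a_{k+2}
bwd : ℤ → ℤ → ℤ → ℕ → ℤ × ℤ
bwd n a0 a1 zero = a0 , a1
bwd n a0 a1 (suc k) with bwd n a0 a1 k
... | x , y = n * x - y , x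

recSeq : ℤ → ℤ → ℤ → ℤ → ℤ
recSeq n a0 a1 (+ k) = proj₁ (fwd n a0 a1 k)
recSeq n a0 a1 -[1+ k ] = proj₁ (bwd n a0 a1 (suc k))

s : ℤ → ℤ → ℤ
s k n = recSeq n (+ 1) (n + + 1) k

r : ℤ → ℤ → ℤ
r k n = recSeq n (+ 1) (n - + 1) k

-- dilated Chebyshev polynomials of the second kind, evaluated at x:
-- U_0 = 1, U_1(x) = x
U : ℤ → ℤ → ℤ
U k x = recSeq x (+ 1) x k

{-# OPTIONS --safe #-}
-- Every solution of a(k+2) = n a(k+1) - a(k) satisfies a(m+k) = a(m) U(k) - a(m-1) U(k-1),
-- since both sides solve the recurrence in k and agree at k = 0, 1.  With m = 0 this gives
-- s(k) = U(k) + U(k-1) and r(k) = U(k) - U(k-1); with m, k near j it expresses U(2j) and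
-- U(2j ± 1) through a = U(j), b = U(j-1).  Both identities then become ring identities modulo
-- Cassini's relation a² - nab + b² = 1, which holds because U(k)² - U(k-1) U(k+1) is
-- constant in k.
module Submission where

open import Defs
open import Data.Integer using (ℤ; +_; -[1+_]; _+_; _-_; _*_; -_)
open import Data.Integer.Properties using (+-identityˡ; +-identityʳ; +-comm)
open import Data.Integer.Tactic.RingSolver using (solve-∀)
open import Data.Nat using (zero; suc)
import Data.Nat as ℕ
import Data.Nat.Properties as ℕₚ
open import Function using (_∘_)
open import Data.Product using (_×_; _,_; proj₁)
open import Relation.Binary.PropositionalEquality
  using (_≡_; refl; sym; trans; cong; cong₂; subst; module ≡-Reasoning)

ℤ-induction : (P : ℤ → Set) → P (+ 0) → (∀ k → P k → P (k + + 1)) →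
              (∀ k → P (k + + 1) → P k) → ∀ k → P k
ℤ-induction P P0 up down (+ zero)     = P0
ℤ-induction P P0 up down (+ suc m)    =
  subst P (cong +_ (ℕₚ.+-comm m 1)) (up (+ m) (ℤ-induction P P0 up down (+ m)))
ℤ-induction P P0 up down -[1+ zero ]  = down -[1+ zero ] P0
ℤ-induction P P0 up down -[1+ suc m ] = down -[1+ suc m ] (ℤ-induction P P0 up down -[1+ m ])

x≡a-z⇒z≡a-x : ∀ a {x} z → x ≡ a - z → z ≡ a - x
x≡a-z⇒z≡a-x a z refl = lemma a z
  where
  lemma : ∀ a z → z ≡ a - (a - z)
  lemma = solve-∀

k+1+1≡k+2 : ∀ k → k + + 1 + + 1 ≡ k + + 2
k+1+1≡k+2 = solve-∀

k+1-1≡k : ∀ k → k + + 1 - + 1 ≡ k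
k+1-1≡k = solve-∀

k-1+1≡k : ∀ k → k - + 1 + + 1 ≡ k
k-1+1≡k = solve-∀

k-1+2≡k+1 : ∀ k → k - + 1 + + 2 ≡ k + + 1
k-1+2≡k+1 = solve-∀

record Recurrent (n : ℤ) (f : ℤ → ℤ) : Set where
  constructor recurrent
  field step : ∀ k → f (k + + 2) ≡ n * f (k + + 1) - f k

module _ {n : ℤ} {f : ℤ → ℤ} (rec : Recurrent n f) where
  open Recurrent rec

  recurrent-forward : ∀ k → f (k + + 1 + + 1) ≡ n * f (k + + 1) - f k
  recurrent-forward k = trans (cong f (k+1+1≡k+2 k)) (step k)

  recurrent-backward : ∀ k → f k ≡ n * f (k + + 1) - f (k + + 1 + + 1)
  recurrent-backward k = x≡a-z⇒z≡a-x (n * f (k + + 1)) (f k) (recurrent-forward k)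

  recurrent-suc : ∀ k → f (k + + 1) ≡ n * f k - f (k - + 1)
  recurrent-suc k = begin
    f (k + + 1)                            ≡⟨ cong f (sym (k-1+2≡k+1 k)) ⟩
    f (k - + 1 + + 2)                      ≡⟨ step (k - + 1) ⟩
    n * f (k - + 1 + + 1) - f (k - + 1)    ≡⟨ cong (λ i → n * f i - f (k - + 1)) (k-1+1≡k k) ⟩
    n * f k - f (k - + 1)                  ∎
    where open ≡-Reasoning

  recurrent-pred : ∀ k → f (k - + 1) ≡ n * f k - f (k + + 1)
  recurrent-pred k = x≡a-z⇒z≡a-x (n * f k) (f (k - + 1)) (recurrent-suc k)

  recurrent-shift : ∀ t → Recurrent n (λ k → f (k + t))
  recurrent-shift t = recurrent λ k → begin
    f (k + + 2 + t)                  ≡⟨ cong f (shift₂ k t) ⟩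
    f (k + t + + 2)                  ≡⟨ step (k + t) ⟩
    n * f (k + t + + 1) - f (k + t)  ≡⟨ cong (λ i → n * f i - f (k + t)) (shift₁ k t) ⟩
    n * f (k + + 1 + t) - f (k + t)  ∎
    where
    open ≡-Reasoning
    shift₁ : ∀ k t → k + t + + 1 ≡ k + + 1 + t
    shift₁ = solve-∀
    shift₂ : ∀ k t → k + + 2 + t ≡ k + t + + 2
    shift₂ = solve-∀

recurrent-linear : ∀ {n f g} → Recurrent n f → Recurrent n g →
                   ∀ a b → Recurrent n (λ k → a * f k - b * g k)
recurrent-linear {n} {f} {g} (recurrent recf) (recurrent recg) a b = recurrent λ k →
  trans (cong₂ (λ x y → a * x - b * y) (recf k) (recg k))
        (lemma n a b (f (k + + 1)) (f k) (g (k + + 1)) (g k))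
  where
  lemma : ∀ n a b x y u v →
          a * (n * x - y) - b * (n * u - v) ≡ n * (a * x - b * u) - (a * y - b * v)
  lemma = solve-∀

recurrent-unique : ∀ {n f g} → Recurrent n f → Recurrent n g →
                   f (+ 0) ≡ g (+ 0) → f (+ 1) ≡ g (+ 1) → ∀ k → f k ≡ g k
recurrent-unique {n} {f} {g} recf recg f0≡g0 f1≡g1 k =
  proj₁ (ℤ-induction Agree (f0≡g0 , f1≡g1) up down k)
  where
  Agree : ℤ → Set
  Agree k = f k ≡ g k × f (k + + 1) ≡ g (k + + 1)
  up : ∀ k → Agree k → Agree (k + + 1)
  up k (e₀ , e₁) = e₁ , trans (recurrent-forward recf k)
    (trans (cong₂ (λ x y → n * x - y) e₁ e₀) (sym (recurrent-forward recg k)))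
  down : ∀ k → Agree (k + + 1) → Agree k
  down k (e₁ , e₂) = trans (recurrent-backward recf k)
    (trans (cong₂ (λ x y → n * x - y) e₁ e₂) (sym (recurrent-backward recg k))) , e₁

module _ (n a₀ a₁ : ℤ) where

  fwd-step : ∀ k → proj₁ (fwd n a₀ a₁ (suc (suc k)))
                 ≡ n * proj₁ (fwd n a₀ a₁ (suc k)) - proj₁ (fwd n a₀ a₁ k)
  fwd-step k with fwd n a₀ a₁ k
  ... | _ , _ = refl

  bwd-step : ∀ k → proj₁ (bwd n a₀ a₁ (suc (suc k)))
                 ≡ n * proj₁ (bwd n a₀ a₁ (suc k)) - proj₁ (bwd n a₀ a₁ k)
  bwd-step k with bwd n a₀ a₁ k
  ... | _ , _ = refl

  recSeq-backward : ∀ k → recSeq n a₀ a₁ -[1+ k ]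
                        ≡ n * recSeq n a₀ a₁ (-[1+ k ] + + 1) - recSeq n a₀ a₁ (-[1+ k ] + + 2)
  -- Split so that the index -[1+ k ] + + 2 computes.
  recSeq-backward zero          = refl
  recSeq-backward (suc zero)    = bwd-step zero
  recSeq-backward (suc (suc p)) = bwd-step (suc p)

  recSeq-recurrent : Recurrent n (recSeq n a₀ a₁)
  recSeq-recurrent = recurrent step
    where
    open ≡-Reasoning
    f : ℤ → ℤ
    f = recSeq n a₀ a₁
    step : ∀ k → f (k + + 2) ≡ n * f (k + + 1) - f k
    step (+ m) = begin
      proj₁ (fwd n a₀ a₁ (m ℕ.+ 2))              ≡⟨ cong (proj₁ ∘ fwd n a₀ a₁) (ℕₚ.+-comm m 2) ⟩
      proj₁ (fwd n a₀ a₁ (suc (suc m)))          ≡⟨ fwd-step m ⟩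
      n * proj₁ (fwd n a₀ a₁ (suc m)) - f (+ m)  ≡⟨ cong (λ i → n * proj₁ (fwd n a₀ a₁ i) - f (+ m)) (ℕₚ.+-comm 1 m) ⟩
      n * f (+ m + + 1) - f (+ m)                ∎
    step -[1+ k ] = x≡a-z⇒z≡a-x (n * f (-[1+ k ] + + 1)) (f (-[1+ k ] + + 2)) (recSeq-backward k)

U-recurrent : ∀ n → Recurrent n (λ k → U k n)
U-recurrent n = recSeq-recurrent n (+ 1) n

recurrent-+ : ∀ {n f} → Recurrent n f →
              ∀ m k → f (k + m) ≡ f m * U k n - f (m - + 1) * U (k - + 1) n
recurrent-+ {n} {f} rec m =
  recurrent-unique (recurrent-shift rec m)
    (recurrent-linear (U-recurrent n) (recurrent-shift (U-recurrent n) (- + 1)) (f m) (f (m - + 1)))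
    (trans (cong f (+-identityˡ m)) (at-0 n (f m) (f (m - + 1))))
    (trans (cong f (+-comm (+ 1) m)) (trans (recurrent-suc rec m) (at-1 n (f m) (f (m - + 1)))))
  where
  at-0 : ∀ n x y → x ≡ x * + 1 - y * (n * + 1 - n)
  at-0 = solve-∀
  at-1 : ∀ n x y → n * x - y ≡ x * n - y * + 1
  at-1 = solve-∀

recSeq-as-U : ∀ n a₀ a₁ k → recSeq n a₀ a₁ k ≡ a₀ * U k n - (n * a₀ - a₁) * U (k - + 1) n
recSeq-as-U n a₀ a₁ k =
  trans (cong (recSeq n a₀ a₁) (sym (+-identityʳ k))) (recurrent-+ (recSeq-recurrent n a₀ a₁) (+ 0) k)

s-as-U : ∀ k n → s k n ≡ U k n + U (k - + 1) n
s-as-U k n = trans (recSeq-as-U n (+ 1) (n + + 1) k) (lemma n (U k n) (U (k - + 1) n))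
  where
  lemma : ∀ n x y → + 1 * x - (n * + 1 - (n + + 1)) * y ≡ x + y
  lemma = solve-∀

r-as-U : ∀ k n → r k n ≡ U k n - U (k - + 1) n
r-as-U k n = trans (recSeq-as-U n (+ 1) (n - + 1) k) (lemma n (U k n) (U (k - + 1) n))
  where
  lemma : ∀ n x y → + 1 * x - (n * + 1 - (n - + 1)) * y ≡ x - y
  lemma = solve-∀

cassini : (ℤ → ℤ) → ℤ → ℤ
cassini f k = f k * f k - f (k - + 1) * f (k + + 1)

recurrent-cassini : ∀ {n f} → Recurrent n f → ∀ k → cassini f k ≡ cassini f (+ 0)
recurrent-cassini {n} {f} rec =
  ℤ-induction (λ k → cassini f k ≡ cassini f (+ 0)) refl
    (λ k eq → trans (cassini-suc k) eq) (λ k eq → trans (sym (cassini-suc k)) eq)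
  where
  open ≡-Reasoning
  lemma : ∀ n A B → B * B - A * (n * B - A) ≡ A * A - (n * A - B) * B
  lemma = solve-∀
  cassini-suc : ∀ k → cassini f (k + + 1) ≡ cassini f k
  cassini-suc k = begin
    B * B - f (k + + 1 - + 1) * f (k + + 1 + + 1)
      ≡⟨ cong₂ (λ x y → B * B - x * y) (cong f (k+1-1≡k k)) (recurrent-forward rec k) ⟩
    B * B - A * (n * B - A)  ≡⟨ lemma n A B ⟩
    A * A - (n * A - B) * B  ≡⟨ cong (λ x → A * A - x * B) (recurrent-pred rec k) ⟨
    cassini f k              ∎
    where
    A B : ℤ
    A = f k
    B = f (k + + 1)

U-cassini : ∀ n j → U j n * U j n - U (j - + 1) n * (n * U j n - U (j - + 1) n) ≡ + 1
U-cassini n j = begin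
  U j n * U j n - U (j - + 1) n * (n * U j n - U (j - + 1) n)
    ≡⟨ cong (λ x → U j n * U j n - U (j - + 1) n * x) (recurrent-suc (U-recurrent n) j) ⟨
  cassini (λ k → U k n) j      ≡⟨ recurrent-cassini (U-recurrent n) j ⟩
  + 1 * + 1 - (n * + 1 - n) * n  ≡⟨ lemma n ⟩
  + 1                          ∎
  where
  open ≡-Reasoning
  lemma : ∀ n → + 1 * + 1 - (n * + 1 - n) * n ≡ + 1
  lemma = solve-∀

U-double : ∀ n j → U (+ 2 * j) n ≡ U j n * U j n - U (j - + 1) n * U (j - + 1) n
U-double n j = trans (cong (λ i → U i n) (index j)) (recurrent-+ (U-recurrent n) j j)
  where
  index : ∀ j → + 2 * j ≡ j + j
  index = solve-∀

U-double-pred : ∀ n j → U (+ 2 * j - + 1) n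
                      ≡ U j n * U (j - + 1) n - U (j - + 1) n * (n * U (j - + 1) n - U j n)
U-double-pred n j = begin
  U (+ 2 * j - + 1) n          ≡⟨ cong (λ i → U i n) (index j) ⟩
  U (j - + 1 + j) n            ≡⟨ recurrent-+ (U-recurrent n) j (j - + 1) ⟩
  U j n * U (j - + 1) n - U (j - + 1) n * U (j - + 1 - + 1) n
    ≡⟨ cong (λ x → U j n * U (j - + 1) n - U (j - + 1) n * x) (recurrent-pred (U-recurrent n) (j - + 1)) ⟩
  U j n * U (j - + 1) n - U (j - + 1) n * (n * U (j - + 1) n - U (j - + 1 + + 1) n)
    ≡⟨ cong (λ i → U j n * U (j - + 1) n - U (j - + 1) n * (n * U (j - + 1) n - U i n)) (k-1+1≡k j) ⟩
  U j n * U (j - + 1) n - U (j - + 1) n * (n * U (j - + 1) n - U j n) ∎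
  where
  open ≡-Reasoning
  index : ∀ j → + 2 * j - + 1 ≡ j - + 1 + j
  index = solve-∀

U-double-suc : ∀ n j → U (+ 2 * j + + 1) n ≡ (n * U j n - U (j - + 1) n) * U j n - U j n * U (j - + 1) n
U-double-suc n j = begin
  U (+ 2 * j + + 1) n          ≡⟨ cong (λ i → U i n) (index j) ⟩
  U (j + (j + + 1)) n          ≡⟨ recurrent-+ (U-recurrent n) (j + + 1) j ⟩
  U (j + + 1) n * U j n - U (j + + 1 - + 1) n * U (j - + 1) n
    ≡⟨ cong₂ (λ x i → x * U j n - U i n * U (j - + 1) n) (recurrent-suc (U-recurrent n) j) (k+1-1≡k j) ⟩
  (n * U j n - U (j - + 1) n) * U j n - U j n * U (j - + 1) n ∎
  where
  open ≡-Reasoning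
  index : ∀ j → + 2 * j + + 1 ≡ j + (j + + 1)
  index = solve-∀

-- Writing Cassini's expression in place of the constant 1 leaves a pure ring identity.
even-factorisation : ∀ n a b → a * a - b * (n * a - b) ≡ + 1 →
  (a * a - b * b) + (a * b - b * (n * b - a)) - + 1 ≡ (n + + 2) * (a - b) * b
even-factorisation n a b cas =
  subst (λ e → (a * a - b * b) + (a * b - b * (n * b - a)) - e ≡ (n + + 2) * (a - b) * b) cas (lemma n a b)
  where
  lemma : ∀ n a b → (a * a - b * b) + (a * b - b * (n * b - a)) - (a * a - b * (n * a - b))
                  ≡ (n + + 2) * (a - b) * b
  lemma = solve-∀

odd-factorisation : ∀ n a b → a * a - b * (n * a - b) ≡ + 1 →
  ((n * a - b) * a - a * b) + (a * a - b * b) + + 1 ≡ (n + + 2) * (a - b) * a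
odd-factorisation n a b cas =
  subst (λ e → ((n * a - b) * a - a * b) + (a * a - b * b) + e ≡ (n + + 2) * (a - b) * a) cas (lemma n a b)
  where
  lemma : ∀ n a b → ((n * a - b) * a - a * b) + (a * a - b * b) + (a * a - b * (n * a - b))
                  ≡ (n + + 2) * (a - b) * a
  lemma = solve-∀

proposition24 : (n j : ℤ) →
    (s (+ 2 * j) n - + 1 ≡ (n + + 2) * r j n * U (j - + 1) n)
    × (s (+ 2 * j + + 1) n + + 1 ≡ (n + + 2) * r j n * U j n)
proposition24 n j = even , odd
  where
  open ≡-Reasoning
  a b : ℤ
  a = U j n
  b = U (j - + 1) n
  even : s (+ 2 * j) n - + 1 ≡ (n + + 2) * r j n * b
  even = begin
    s (+ 2 * j) n - + 1                             ≡⟨ cong (_- + 1) (s-as-U (+ 2 * j) n) ⟩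
    U (+ 2 * j) n + U (+ 2 * j - + 1) n - + 1
      ≡⟨ cong₂ (λ x y → x + y - + 1) (U-double n j) (U-double-pred n j) ⟩
    (a * a - b * b) + (a * b - b * (n * b - a)) - + 1 ≡⟨ even-factorisation n a b (U-cassini n j) ⟩
    (n + + 2) * (a - b) * b                         ≡⟨ cong (λ x → (n + + 2) * x * b) (r-as-U j n) ⟨
    (n + + 2) * r j n * b                           ∎
  odd : s (+ 2 * j + + 1) n + + 1 ≡ (n + + 2) * r j n * a
  odd = begin
    s (+ 2 * j + + 1) n + + 1                       ≡⟨ cong (_+ + 1) (s-as-U (+ 2 * j + + 1) n) ⟩
    U (+ 2 * j + + 1) n + U (+ 2 * j + + 1 - + 1) n + + 1
      ≡⟨ cong₂ (λ x y → x + y + + 1) (U-double-suc n j)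
               (trans (cong (λ i → U i n) (k+1-1≡k (+ 2 * j))) (U-double n j)) ⟩
    ((n * a - b) * a - a * b) + (a * a - b * b) + + 1 ≡⟨ odd-factorisation n a b (U-cassini n j) ⟩
    (n + + 2) * (a - b) * a                         ≡⟨ cong (λ x → (n + + 2) * x * a) (r-as-U j n) ⟨
    (n + + 2) * r j n * a                           ∎
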